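{- Let $G$ be a bipartite graph with bipartition $(X,Y)$ and let $u,v\in X$. Then for every $k\ge 0$ the graph $H=G_{u\to v}$ satisfies $m_k(H)\le m_k(G)$.
   Context: For a graph $G$ and vertices $x,y$, let $N_G(x,\overline{y})=\{w\in V(G)\setminus\{x,y\}: w\sim x,\ w\not\sim y\}$. The compression $G_{x\to y}$ is the graph obtained from $G$ by deleting all edges between $x$ and $N_G(x,\overline{y})$ and adding all edges from $y$ to $N_G(x,\overline{y})$. A matching is a set of pairwise non-incident edges; $m_k(G)$ is the number of matchings of $G$ with exactly $k$ edges. -}

module Defs where

open import Data.Nat using (ℕ; _<ᵇ_)
open import Data.Fin using (Fin; toℕ; _≟_)
open import Data.Bool using (Bool; true; false; _∧_; _∨_; not; if_then_else_)
open import Data.List using (List; []; _∷_; length; filterᵇ; concatMap; allFin; _++_; map)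
open import Relation.Nullary.Decidable using (⌊_⌋)
open import Relation.Binary.PropositionalEquality using (_≡_)

record Graph (n : ℕ) : Set where
  field
    adj     : Fin n → Fin n → Bool
    sym     : ∀ x y → adj x y ≡ adj y x
    irrefl  : ∀ x → adj x x ≡ false
open Graph public

_==_ : ∀ {n} → Fin n → Fin n → Bool
a == b = ⌊ a ≟ b ⌋

-- Bipartition (X,Y): side x ≡ true means x ∈ X, false means x ∈ Y;
-- every edge joins X and Y.
IsBipartition : ∀ {n} → Graph n → (Fin n → Bool) → Set
IsBipartition G side = ∀ x y → adj G x y ≡ true → side x ≡ not (side y)

-- w ∈ N_G(x, ȳ) : w ∉ {x,y}, w ~ x, w ≁ y
inN : ∀ {n} → (Fin n → Fin n → Bool) → Fin n → Fin n → Fin n → Bool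
inN a x y w = not (w == x) ∧ not (w == y) ∧ a x w ∧ not (a y w)

-- adjacency of the compression G_{x→y}: delete edges x–N(x,ȳ),
-- add edges y–N(x,ȳ)
compressAdj : ∀ {n} → (Fin n → Fin n → Bool) → Fin n → Fin n → Fin n → Fin n → Bool
compressAdj a x y p q =
  (a p q ∧ not ((p == x) ∧ inN a x y q) ∧ not ((q == x) ∧ inN a x y p))
  ∨ ((p == y) ∧ inN a x y q) ∨ ((q == y) ∧ inN a x y p)

record Edge (n : ℕ) : Set where
  constructor _,_
  field
    fst snd : Fin n

edges : ∀ {n} → (Fin n → Fin n → Bool) → List (Edge n)
edges {n} a = concatMap (λ i → concatMap (λ j →
  if (toℕ i <ᵇ toℕ j) ∧ a i j then (i , j) ∷ [] else []) (allFin n)) (allFin n)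

subsets : ∀ {A : Set} → List A → List (List A)
subsets [] = [] ∷ []
subsets (x ∷ xs) = let s = subsets xs in s ++ map (x ∷_) s

disjoint : ∀ {n} → Edge n → Edge n → Bool
disjoint (a , b) (c , d) = not (a == c) ∧ not (a == d) ∧ not (b == c) ∧ not (b == d)

allB : ∀ {A : Set} → (A → Bool) → List A → Bool
allB p [] = true
allB p (x ∷ xs) = p x ∧ allB p xs

isMatching : ∀ {n} → List (Edge n) → Bool
isMatching [] = true
isMatching (e ∷ es) = allB (disjoint e) es ∧ isMatching es

mk : ∀ {n} → (Fin n → Fin n → Bool) → ℕ → ℕ
mk a k = length (filterᵇ (λ M → ⌊ length M Data.Nat.≟ k ⌋ ∧ isMatching M) (subsets (edges a)))
  where import Data.Nat

module Submission where

-- Write H = G_{u→v} and N = N_G(u, v̄).  The edges of H outside G are exactly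
-- the edges v–w with w ∈ N, and H has no edge u–w with w ∈ N.  We map the
-- k-matchings of H injectively into the k-matchings of G:
--   * a matching S of H with no edge v–w (w ∈ N) is already a matching of G;
--   * otherwise S contains one such edge v–w, and exchanging the labels u and
--     v turns S into a matching of G: v–w becomes u–w, and an edge u–y of S
--     becomes v–y, which lies in G since y ∉ N.
-- Swapped matchings contain an edge u–w with w ∈ N and unswapped ones do not,
-- so the map has a left inverse, and counting gives the inequality.
--
-- As in mk, edge sets are sub-collections of the edge list; all of them are
-- sub-collections of the list allPairs of all pairs i < j, and relabelled edge
-- sets are rebuilt in this canonical form as filters of allPairs.

open import Data.Bool using (Bool; true; false; _∧_; _∨_; not; if_then_else_)
open import Data.Bool.Properties using (T-≡; T-∧; ∧-assoc; ∧-comm; ∨-comm) renaming (_≟_ to _≟ᴮ_)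
open import Data.Empty using (⊥-elim)
open import Data.Fin using (Fin; toℕ; _≟_)
open import Data.Fin.Permutation.Components using (transpose; transpose-inverse)
open import Data.Fin.Properties using (toℕ-injective; any?)
open import Data.List using (List; []; _∷_; length; filter; filterᵇ; concatMap; _++_; map; allFin)
open import Data.List.Membership.Propositional using (_∈_; _∉_; find; lose)
open import Data.List.Membership.Propositional.Properties
  using (∈-++⁻; ∈-++⁺ˡ; ∈-++⁺ʳ; ∈-∃++; ∈-map⁻; ∈-map⁺; ∈-filter⁻; ∈-filter⁺;
         ∈-concatMap⁻; ∈-concatMap⁺; ∈-allFin)
open import Data.List.Properties
  using (concatMap-cong; length-++; filter-++; filter-accept; filter-reject; ∷-injectiveʳ; ++-identityʳ)
open import Data.List.Relation.Unary.All using ([]; _∷_)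
open import Data.List.Relation.Unary.AllPairs using ([]; _∷_)
open import Data.List.Relation.Unary.Any using (here; there)
open import Data.List.Relation.Unary.Unique.Propositional using (Unique)
import Data.List.Relation.Unary.Unique.Propositional.Properties as Unique
open import Data.Nat using (ℕ; suc; _≤_; _<_; _<ᵇ_; z≤n; s≤s)
import Data.Nat as Nat
open import Data.Nat.Properties
  using (+-suc; ≤-trans; ≤-reflexive; ≤-antisym; <ᵇ⇒<; <⇒<ᵇ; <ᵇ-reflects-<; <-irrefl; <⇒≯; <-cmp)
open import Data.Product using (∃; _×_; _,_; proj₁; proj₂)
open import Data.Sum using (_⊎_; inj₁; inj₂; reduce)
open import Function using (_∘_; Equivalence; mk⇔)
open import Level using (Level)
open import Relation.Binary.Definitions using (DecidableEquality; tri<; tri≈; tri>)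
open import Relation.Binary.PropositionalEquality
open import Relation.Nullary using (¬_; Dec; does; yes; no; contradiction)
open import Relation.Nullary.Decidable
  using (T?; ⌊_⌋; toWitness; fromWitness; map′; _×-dec_; dec-true; dec-false; does-⇔; isYes≗does)
open import Relation.Nullary.Reflects using (ofʸ; ofⁿ)
open import Relation.Unary using (Pred; Decidable)
open import Defs hiding (sym)

private
  variable
    A B : Set
    ℓ : Level

∧-true⁻ : ∀ {x y} → x ∧ y ≡ true → x ≡ true × y ≡ true
∧-true⁻ {true} y≡true = refl , y≡true

∨-true⁻ : ∀ {x y} → x ∨ y ≡ true → x ≡ true ⊎ y ≡ true
∨-true⁻ {true}  _      = inj₁ refl
∨-true⁻ {false} y≡true = inj₂ y≡true

not-true⁻ : ∀ {x} → not x ≡ true → x ≡ false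
not-true⁻ {false} _ = refl

not-false⁻ : ∀ {x} → not x ≡ false → x ≡ true
not-false⁻ {true} _ = refl

true≢false : true ≢ false
true≢false ()

∧-swap-halves : ∀ p q r s → p ∧ q ∧ r ∧ s ≡ r ∧ s ∧ p ∧ q
∧-swap-halves p q r s =
  trans (sym (∧-assoc p q (r ∧ s))) (trans (∧-comm (p ∧ q) (r ∧ s)) (∧-assoc r s (p ∧ q)))

∧-swap-middle : ∀ p q r s → p ∧ q ∧ r ∧ s ≡ p ∧ r ∧ q ∧ s
∧-swap-middle p q r s =
  cong (p ∧_) (trans (sym (∧-assoc q r s)) (trans (cong (_∧ s) (∧-comm q r)) (∧-assoc r q s)))

allB⁻ : ∀ (p : A → Bool) {xs x} → allB p xs ≡ true → x ∈ xs → p x ≡ true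
allB⁻ p {y ∷ ys} h (here refl) = proj₁ (∧-true⁻ h)
allB⁻ p {y ∷ ys} h (there x∈ys) = allB⁻ p (proj₂ (∧-true⁻ h)) x∈ys

allB⁺ : ∀ (p : A → Bool) xs → (∀ {x} → x ∈ xs → p x ≡ true) → allB p xs ≡ true
allB⁺ p [] _ = refl
allB⁺ p (x ∷ xs) h rewrite h (here refl) = allB⁺ p xs (h ∘ there)

length-≤-by-retraction : ∀ {xs : List A} {ys : List B} (f : A → B) (g : B → A) →
  Unique xs → (∀ {x} → x ∈ xs → f x ∈ ys) → (∀ {x} → x ∈ xs → g (f x) ≡ x) →
  length xs ≤ length ys
length-≤-by-retraction {xs = []} f g _ _ _ = z≤n
length-≤-by-retraction {xs = x ∷ xs} {ys} f g uniq@(_ ∷ uniq-xs) into retract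
  with ∈-∃++ (into (here refl))
... | l , r , refl = ≤-trans (s≤s rest) (≤-reflexive (sym (length-middle l r)))
  where
  length-middle : ∀ (l r : List B) {y} → length (l ++ y ∷ r) ≡ suc (length (l ++ r))
  length-middle l r = trans (length-++ l) (trans (+-suc (length l) (length r)) (cong suc (sym (length-++ l))))

  delete : ∀ {y} → y ∈ l ++ f x ∷ r → y ≢ f x → y ∈ l ++ r
  delete y∈ y≢ with ∈-++⁻ l y∈
  ... | inj₁ y∈l = ∈-++⁺ˡ y∈l
  ... | inj₂ (here y≡) = contradiction y≡ y≢
  ... | inj₂ (there y∈r) = ∈-++⁺ʳ l y∈r

  -- g separates x from the other elements, so f x is not hit twice
  fresh : ∀ {x'} → x' ∈ xs → f x' ≢ f x
  fresh {x'} x'∈ fx'≡fx = Unique.Unique[x∷xs]⇒x∉xs uniq (subst (_∈ xs) x'≡x x'∈)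
    where
    x'≡x : x' ≡ x
    x'≡x = trans (sym (retract (there x'∈))) (trans (cong g fx'≡fx) (retract (here refl)))

  rest : length xs ≤ length (l ++ r)
  rest = length-≤-by-retraction f g uniq-xs
    (λ x'∈ → delete (into (there x'∈)) (fresh x'∈)) (retract ∘ there)

filter-cong : ∀ {P Q : Pred A ℓ} (P? : Decidable P) (Q? : Decidable Q) xs →
  (∀ {x} → x ∈ xs → P x → Q x) → (∀ {x} → x ∈ xs → Q x → P x) →
  filter P? xs ≡ filter Q? xs
filter-cong P? Q? [] _ _ = refl
filter-cong P? Q? (x ∷ xs) P⇒Q Q⇒P with P? x
... | yes Px = trans (cong (x ∷_) (filter-cong P? Q? xs (P⇒Q ∘ there) (Q⇒P ∘ there)))
                     (sym (filter-accept Q? (P⇒Q (here refl) Px)))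
... | no ¬Px = trans (filter-cong P? Q? xs (P⇒Q ∘ there) (Q⇒P ∘ there))
                     (sym (filter-reject Q? (¬Px ∘ Q⇒P (here refl))))

∈-subsets⇒⊆ : ∀ (xs : List A) {S y} → S ∈ subsets xs → y ∈ S → y ∈ xs
∈-subsets⇒⊆ [] (here refl) ()
∈-subsets⇒⊆ (x ∷ xs) S∈ y∈S with ∈-++⁻ (subsets xs) S∈
... | inj₁ S∈ˡ = there (∈-subsets⇒⊆ xs S∈ˡ y∈S)
... | inj₂ S∈ʳ with ∈-map⁻ (x ∷_) S∈ʳ
...   | S' , S'∈ , refl with y∈S
...     | here y≡x  = here y≡x
...     | there y∈S' = there (∈-subsets⇒⊆ xs S'∈ y∈S')

filter∈subsets : ∀ {P : Pred A ℓ} (P? : Decidable P) xs → filter P? xs ∈ subsets xs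
filter∈subsets P? [] = here refl
filter∈subsets P? (x ∷ xs) with P? x
... | yes _ = ∈-++⁺ʳ (subsets xs) (∈-map⁺ (x ∷_) (filter∈subsets P? xs))
... | no _  = ∈-++⁺ˡ (filter∈subsets P? xs)

subsets-unique : ∀ {xs : List A} → Unique xs → Unique (subsets xs)
subsets-unique {xs = []} [] = [] ∷ []
subsets-unique {xs = x ∷ xs} uniq@(_ ∷ uniq-xs) =
  Unique.++⁺ ih (Unique.map⁺ ∷-injectiveʳ ih) λ (S∈ˡ , S∈ʳ) →
    let (_ , _ , S≡) = ∈-map⁻ (x ∷_) S∈ʳ
    in Unique.Unique[x∷xs]⇒x∉xs uniq (∈-subsets⇒⊆ xs S∈ˡ (subst (x ∈_) (sym S≡) (here refl)))
  where
  ih : Unique (subsets xs)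
  ih = subsets-unique uniq-xs

subsets-filter : ∀ {A : Set} (p : A → Bool) xs → subsets (filterᵇ p xs) ≡ filterᵇ (allB p) (subsets xs)
subsets-filter p [] = refl
subsets-filter {A} p (x ∷ xs) with p x in px
... | true  = begin
  ss ++ map (x ∷_) ss                   ≡⟨ cong (λ s → s ++ map (x ∷_) s) (subsets-filter p xs) ⟩
  F s ++ map (x ∷_) (F s)               ≡⟨ cong (F s ++_) (sym (extend (subsets xs))) ⟩
  F s ++ F (map (x ∷_) s)               ≡⟨ sym (filter-++ (T? ∘ allB p) s _) ⟩
  F (s ++ map (x ∷_) s)                 ∎
  where
  open ≡-Reasoning
  F : List (List A) → List (List A)
  F = filterᵇ (allB p)
  s ss : List (List A)
  s = subsets xs
  ss = subsets (filterᵇ p xs)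
  extend : ∀ ts → F (map (x ∷_) ts) ≡ map (x ∷_) (F ts)
  extend [] = refl
  extend (t ∷ ts) rewrite px with allB p t
  ... | true  = cong ((x ∷ t) ∷_) (extend ts)
  ... | false = extend ts
... | false = begin
  ss                       ≡⟨ subsets-filter p xs ⟩
  F s                      ≡⟨ sym (++-identityʳ (F s)) ⟩
  F s ++ []                ≡⟨ cong (F s ++_) (sym (discard (subsets xs))) ⟩
  F s ++ F (map (x ∷_) s)  ≡⟨ sym (filter-++ (T? ∘ allB p) s _) ⟩
  F (s ++ map (x ∷_) s)    ∎
  where
  open ≡-Reasoning
  F : List (List A) → List (List A)
  F = filterᵇ (allB p)
  s ss : List (List A)
  s = subsets xs
  ss = subsets (filterᵇ p xs)
  discard : ∀ ts → F (map (x ∷_) ts) ≡ []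
  discard [] = refl
  discard (t ∷ ts) rewrite px = discard ts

module Canonical (_≟ᴬ_ : DecidableEquality A) where
  open import Data.List.Membership.DecPropositional _≟ᴬ_ public using (_∈?_)

  subset-canonical : ∀ {xs} → Unique xs → ∀ {S} → S ∈ subsets xs → S ≡ filter (_∈? S) xs
  subset-canonical {[]} [] (here refl) = refl
  subset-canonical {x ∷ xs} uniq@(_ ∷ uniq-xs) {S} S∈ with ∈-++⁻ (subsets xs) S∈
  ... | inj₁ S∈ˡ = trans (subset-canonical uniq-xs S∈ˡ)
                         (sym (filter-reject (_∈? S) (x∉xs ∘ ∈-subsets⇒⊆ xs S∈ˡ)))
    where
    x∉xs : x ∉ xs
    x∉xs = Unique.Unique[x∷xs]⇒x∉xs uniq
  ... | inj₂ S∈ʳ with ∈-map⁻ (x ∷_) S∈ʳ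
  ...   | S' , S'∈ , refl =
    trans (cong (x ∷_) (trans (subset-canonical uniq-xs S'∈)
                              (filter-cong (_∈? S') (_∈? S) xs (λ _ → there) drop-x)))
          (sym (filter-accept (_∈? S) (here refl)))
    where
    x∉xs : x ∉ xs
    x∉xs = Unique.Unique[x∷xs]⇒x∉xs uniq
    drop-x : ∀ {y} → y ∈ xs → y ∈ x ∷ S' → y ∈ S'
    drop-x y∈xs (here refl) = contradiction y∈xs x∉xs
    drop-x _    (there y∈S') = y∈S'

  subset-unique : ∀ {xs} → Unique xs → ∀ {S} → S ∈ subsets xs → Unique S
  subset-unique uniq {S} S∈ = subst Unique (sym (subset-canonical uniq S∈)) (Unique.filter⁺ (_∈? S) uniq)

concatMap-unique : ∀ {xs : List A} (f : A → List B) (tag : B → A) → Unique xs →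
  (∀ x → Unique (f x)) → (∀ x {y} → y ∈ f x → tag y ≡ x) → Unique (concatMap f xs)
concatMap-unique {xs = []} f tag [] _ _ = []
concatMap-unique {xs = x ∷ xs} f tag uniq@(_ ∷ uniq-xs) uniq-f tagged =
  Unique.++⁺ (uniq-f x) (concatMap-unique f tag uniq-xs uniq-f tagged) λ (y∈fx , y∈rest) →
    let (x' , x'∈xs , y∈fx') = find (∈-concatMap⁻ f y∈rest)
    in Unique.Unique[x∷xs]⇒x∉xs uniq
         (subst (_∈ xs) (trans (sym (tagged x' y∈fx')) (tagged x y∈fx)) x'∈xs)

filter-concatMap : ∀ (p : B → Bool) (f : A → List B) xs →
  filterᵇ p (concatMap f xs) ≡ concatMap (filterᵇ p ∘ f) xs
filter-concatMap p f [] = refl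
filter-concatMap p f (x ∷ xs) =
  trans (filter-++ (T? ∘ p) (f x) (concatMap f xs)) (cong (filterᵇ p (f x) ++_) (filter-concatMap p f xs))

∈-guard⁻ : ∀ c {e y : A} → y ∈ (if c then e ∷ [] else []) → c ≡ true × y ≡ e
∈-guard⁻ true (here y≡e) = refl , y≡e

∈-guard⁺ : ∀ {c} {e : A} → c ≡ true → e ∈ (if c then e ∷ [] else [])
∈-guard⁺ refl = here refl

guard-unique : ∀ c {e : A} → Unique (if c then e ∷ [] else [])
guard-unique true  = [] ∷ []
guard-unique false = []

filter-guard : ∀ (p : A → Bool) c e →
  filterᵇ p (if c ∧ true then e ∷ [] else []) ≡ (if c ∧ p e then e ∷ [] else [])
filter-guard p false e = refl
filter-guard p true  e with p e
... | true  = refl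
... | false = refl

-- Edges of graphs on Fin n.  `allPairs` lists every pair (i , j) with i < j;
-- the edge list of any graph is a filter of it, and `pair x y` is the
-- representative in allPairs of the unordered pair {x , y}.

module _ {n : ℕ} where
  entry : (Fin n → Fin n → Bool) → Fin n → Fin n → List (Edge n)
  entry b i j = if (toℕ i <ᵇ toℕ j) ∧ b i j then (i , j) ∷ [] else []

  row : (Fin n → Fin n → Bool) → Fin n → List (Edge n)
  row b i = concatMap (entry b i) (allFin n)

  complete : Fin n → Fin n → Bool
  complete _ _ = true

  allPairs : List (Edge n)
  allPairs = edges complete

  joins : (Fin n → Fin n → Bool) → Edge n → Bool
  joins b (i , j) = b i j

  edges-filter : ∀ b → edges b ≡ filterᵇ (joins b) allPairs
  edges-filter b = sym (trans (filter-concatMap (joins b) (row complete) (allFin n))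
    (concatMap-cong (λ i → trans (filter-concatMap (joins b) (entry complete i) (allFin n))
      (concatMap-cong (λ j → filter-guard (joins b) (toℕ i <ᵇ toℕ j) (i , j)) (allFin n))) (allFin n)))

  ∈-allPairs⁻ : ∀ {i j} → (i , j) ∈ allPairs → toℕ i < toℕ j
  ∈-allPairs⁻ e∈ with find (∈-concatMap⁻ (row complete) {xs = allFin n} e∈)
  ... | k , _ , e∈k with find (∈-concatMap⁻ (entry complete k) {xs = allFin n} e∈k)
  ...   | l , _ , e∈kl with ∈-guard⁻ ((toℕ k <ᵇ toℕ l) ∧ true) {e = k , l} e∈kl
  ...     | k<ᵇl , refl = <ᵇ⇒< _ _ (Equivalence.from T-≡ (proj₁ (∧-true⁻ k<ᵇl)))

  ∈-allPairs⁺ : ∀ {i j} → toℕ i < toℕ j → (i , j) ∈ allPairs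
  ∈-allPairs⁺ {i} {j} i<j =
    ∈-concatMap⁺ (row complete) (lose (∈-allFin i) (∈-concatMap⁺ (entry complete i) (lose (∈-allFin j)
      (∈-guard⁺ (cong (_∧ true) (Equivalence.to T-≡ (<⇒<ᵇ i<j)))))))

  allPairs-unique : Unique allPairs
  allPairs-unique = concatMap-unique (row complete) Edge.fst (Unique.allFin⁺ n)
    (λ i → concatMap-unique (entry complete i) Edge.snd (Unique.allFin⁺ n) (λ j → guard-unique _)
      (λ j y∈ → cong Edge.snd (proj₂ (∈-guard⁻ _ y∈))))
    (λ i y∈ → let (j , _ , y∈ij) = find (∈-concatMap⁻ (entry complete i) {xs = allFin n} y∈)
              in cong Edge.fst (proj₂ (∈-guard⁻ _ y∈ij)))

  allPairs-irrefl : ∀ {i j} → (i , j) ∈ allPairs → i ≢ j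
  allPairs-irrefl e∈ refl = <-irrefl refl (∈-allPairs⁻ e∈)

  pair : Fin n → Fin n → Edge n
  pair x y = if toℕ x <ᵇ toℕ y then (x , y) else (y , x)

  pair-< : ∀ {x y} → toℕ x < toℕ y → pair x y ≡ (x , y)
  pair-< {x} {y} x<y with toℕ x <ᵇ toℕ y | <ᵇ-reflects-< (toℕ x) (toℕ y)
  ... | true  | _        = refl
  ... | false | ofⁿ x≮y = contradiction x<y x≮y

  pair-> : ∀ {x y} → toℕ y < toℕ x → pair x y ≡ (y , x)
  pair-> {x} {y} y<x with toℕ x <ᵇ toℕ y | <ᵇ-reflects-< (toℕ x) (toℕ y)
  ... | true  | ofʸ x<y = contradiction x<y (<⇒≯ y<x)
  ... | false | _        = refl

  pair-cases : ∀ x y → pair x y ≡ (x , y) ⊎ pair x y ≡ (y , x)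
  pair-cases x y with toℕ x <ᵇ toℕ y
  ... | true  = inj₁ refl
  ... | false = inj₂ refl

  pair-comm : ∀ {x y} → x ≢ y → pair x y ≡ pair y x
  pair-comm {x} {y} x≢y with <-cmp (toℕ x) (toℕ y)
  ... | tri< x<y _ _ = trans (pair-< x<y) (sym (pair-> x<y))
  ... | tri≈ _ x≡y _ = contradiction (toℕ-injective x≡y) x≢y
  ... | tri> _ _ y<x = trans (pair-> y<x) (sym (pair-< y<x))

  pair∈allPairs : ∀ {x y} → x ≢ y → pair x y ∈ allPairs
  pair∈allPairs {x} {y} x≢y with <-cmp (toℕ x) (toℕ y)
  ... | tri< x<y _ _ = subst (_∈ allPairs) (sym (pair-< x<y)) (∈-allPairs⁺ x<y)
  ... | tri≈ _ x≡y _ = contradiction (toℕ-injective x≡y) x≢y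
  ... | tri> _ _ y<x = subst (_∈ allPairs) (sym (pair-> y<x)) (∈-allPairs⁺ y<x)

  pair-of-edge : ∀ {i j} → (i , j) ∈ allPairs → pair i j ≡ (i , j)
  pair-of-edge e∈ = pair-< (∈-allPairs⁻ e∈)

  pair-proper : ∀ {x y} → pair x y ∈ allPairs → x ≢ y
  pair-proper {x} xy∈ refl = allPairs-irrefl (subst (_∈ allPairs) (reduce (pair-cases x x)) xy∈) refl

  pair-injective : ∀ {x y z} → pair x y ≡ pair x z → y ≡ z
  pair-injective {x} {y} {z} eq with pair-cases x y | pair-cases x z
  ... | inj₁ p₁ | inj₁ p₂ = cong Edge.snd (trans (sym p₁) (trans eq p₂))
  ... | inj₁ p₁ | inj₂ p₂ = let q = trans (sym p₁) (trans eq p₂) in trans (cong Edge.snd q) (cong Edge.fst q)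
  ... | inj₂ p₁ | inj₁ p₂ = let q = trans (sym p₁) (trans eq p₂) in trans (cong Edge.fst q) (cong Edge.snd q)
  ... | inj₂ p₁ | inj₂ p₂ = cong Edge.fst (trans (sym p₁) (trans eq p₂))

  joins-pair : ∀ b → (∀ x y → b x y ≡ b y x) → ∀ x y → joins b (pair x y) ≡ b x y
  joins-pair b b-sym x y with pair-cases x y
  ... | inj₁ p≡ rewrite p≡ = refl
  ... | inj₂ p≡ rewrite p≡ = b-sym y x

  InGraph : (Fin n → Fin n → Bool) → List (Edge n) → Set
  InGraph b S = ∀ {e} → e ∈ S → joins b e ≡ true

  record MatchingOf (b : Fin n → Fin n → Bool) (S : List (Edge n)) : Set where
    field
      subset   : S ∈ subsets allPairs
      in-graph : InGraph b S
      matching : isMatching S ≡ true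

  _≟ᴱ_ : DecidableEquality (Edge n)
  (a , b) ≟ᴱ (c , d) = map′ (λ (a≡c , b≡d) → cong₂ _,_ a≡c b≡d)
                            (λ eq → cong Edge.fst eq , cong Edge.snd eq) ((a ≟ c) ×-dec (b ≟ d))

  ==-does : ∀ (x y : Fin n) → (x == y) ≡ does (x ≟ y)
  ==-does x y = isYes≗does (x ≟ y)

  ==-refl : ∀ (x : Fin n) → (x == x) ≡ true
  ==-refl x = trans (==-does x x) (dec-true (x ≟ x) refl)

  ==-≢ : ∀ {x y : Fin n} → x ≢ y → (x == y) ≡ false
  ==-≢ {x} {y} x≢y = trans (==-does x y) (dec-false (x ≟ y) x≢y)

  ==-false⇒≢ : ∀ {x y : Fin n} → (x == y) ≡ false → x ≢ y
  ==-false⇒≢ {x} eq refl = true≢false (trans (sym (==-refl x)) eq)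

  ==-sound : ∀ {x y : Fin n} → (x == y) ≡ true → x ≡ y
  ==-sound {x} {y} eq with x ≟ y
  ... | yes x≡y = x≡y

  ==-sym : ∀ (x y : Fin n) → (x == y) ≡ (y == x)
  ==-sym x y = trans (==-does x y) (trans (does-⇔ (mk⇔ sym sym) (x ≟ y) (y ≟ x)) (sym (==-does y x)))

  ==-relabel : ∀ (f : Fin n → Fin n) → (∀ {x y} → f x ≡ f y → x ≡ y) →
               ∀ x y → (f x == f y) ≡ (x == y)
  ==-relabel f f-inj x y =
    trans (==-does (f x) (f y)) (trans (does-⇔ (mk⇔ f-inj (cong f)) (f x ≟ f y) (x ≟ y)) (sym (==-does x y)))

  disjoint-swap : ∀ (a b : Fin n) e → disjoint (b , a) e ≡ disjoint (a , b) e
  disjoint-swap a b (c , d) = ∧-swap-halves (not (b == c)) (not (b == d)) (not (a == c)) (not (a == d))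

  disjoint-sym : ∀ (e e' : Edge n) → disjoint e e' ≡ disjoint e' e
  disjoint-sym (a , b) (c , d) rewrite ==-sym a c | ==-sym a d | ==-sym b c | ==-sym b d =
    ∧-swap-middle (not (c == a)) (not (d == a)) (not (c == b)) (not (d == b))

  disjoint-pairˡ : ∀ (a b : Fin n) e → disjoint (pair a b) e ≡ disjoint (a , b) e
  disjoint-pairˡ a b e with pair-cases a b
  ... | inj₁ p≡ = cong (λ p → disjoint p e) p≡
  ... | inj₂ p≡ = trans (cong (λ p → disjoint p e) p≡) (disjoint-swap a b e)

  disjoint-pair : ∀ (a b c d : Fin n) → disjoint (pair a b) (pair c d) ≡ disjoint (a , b) (c , d)
  disjoint-pair a b c d = begin
    disjoint (pair a b) (pair c d) ≡⟨ disjoint-pairˡ a b (pair c d) ⟩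
    disjoint (a , b) (pair c d)    ≡⟨ disjoint-sym (a , b) (pair c d) ⟩
    disjoint (pair c d) (a , b)    ≡⟨ disjoint-pairˡ c d (a , b) ⟩
    disjoint (c , d) (a , b)       ≡⟨ disjoint-sym (c , d) (a , b) ⟩
    disjoint (a , b) (c , d)       ∎
    where open ≡-Reasoning

  disjoint-relabel : ∀ (f : Fin n → Fin n) → (∀ {x y} → f x ≡ f y → x ≡ y) → ∀ a b c d →
    disjoint (f a , f b) (f c , f d) ≡ disjoint (a , b) (c , d)
  disjoint-relabel f f-inj a b c d
    rewrite ==-relabel f f-inj a c | ==-relabel f f-inj a d | ==-relabel f f-inj b c | ==-relabel f f-inj b d = refl

  matching-disjoint : ∀ {S : List (Edge n)} → isMatching S ≡ true →
    ∀ {e e'} → e ∈ S → e' ∈ S → e ≢ e' → disjoint e e' ≡ true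
  matching-disjoint {e ∷ S} M (here refl) (here refl) e≢e' = contradiction refl e≢e'
  matching-disjoint {e ∷ S} M (here refl) (there e'∈) _ = allB⁻ (disjoint e) (proj₁ (∧-true⁻ M)) e'∈
  matching-disjoint {e ∷ S} M (there e∈) (here refl) _ =
    trans (disjoint-sym _ e) (allB⁻ (disjoint e) (proj₁ (∧-true⁻ M)) e∈)
  matching-disjoint {e ∷ S} M (there e∈) (there e'∈) e≢e' = matching-disjoint (proj₂ (∧-true⁻ M)) e∈ e'∈ e≢e'

  matching-intro : ∀ {T : List (Edge n)} → Unique T →
    (∀ {e e'} → e ∈ T → e' ∈ T → e ≢ e' → disjoint e e' ≡ true) → isMatching T ≡ true
  matching-intro {[]} _ _ = refl
  matching-intro {e ∷ T} uniq@(_ ∷ uniq-T) disj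
    rewrite allB⁺ (disjoint e) T (λ e'∈ → disj (here refl) (there e'∈) λ { refl → Unique.Unique[x∷xs]⇒x∉xs uniq e'∈ })
    = matching-intro uniq-T (λ e∈ e'∈ → disj (there e∈) (there e'∈))

  matching-partner-unique : ∀ {S : List (Edge n)} → isMatching S ≡ true →
    ∀ {x y z} → pair x y ∈ S → pair x z ∈ S → y ≡ z
  matching-partner-unique M {x} {y} {z} xy∈ xz∈ with pair x y ≟ᴱ pair x z
  ... | yes eq = pair-injective eq
  ... | no neq = contradiction (trans (sym (matching-disjoint M xy∈ xz∈ neq)) shared) true≢false
    where
    shared : disjoint (pair x y) (pair x z) ≡ false
    shared rewrite disjoint-pair x y x z | ==-refl x = refl

  relabel : (Fin n → Fin n) → Edge n → Edge n
  relabel f (x , y) = pair (f x) (f y)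

  relabel-pair : ∀ f {x y} → f x ≢ f y → relabel f (pair x y) ≡ pair (f x) (f y)
  relabel-pair f {x} {y} fx≢fy with pair-cases x y
  ... | inj₁ p≡ rewrite p≡ = refl
  ... | inj₂ p≡ rewrite p≡ = pair-comm (fx≢fy ∘ sym)

  relabel-∈ : ∀ f → (∀ {x y} → f x ≡ f y → x ≡ y) → ∀ {e} → e ∈ allPairs → relabel f e ∈ allPairs
  relabel-∈ f f-inj {x , y} e∈ = pair∈allPairs (allPairs-irrefl e∈ ∘ f-inj)

  relabel-inverse : ∀ f g → (∀ x → g (f x) ≡ x) → ∀ {e} → e ∈ allPairs → relabel g (relabel f e) ≡ e
  relabel-inverse f g g∘f {x , y} e∈ = begin
    relabel g (pair (f x) (f y)) ≡⟨ relabel-pair g (λ eq → allPairs-irrefl e∈ (trans (sym (g∘f x)) (trans eq (g∘f y)))) ⟩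
    pair (g (f x)) (g (f y))     ≡⟨ cong₂ pair (g∘f x) (g∘f y) ⟩
    pair x y                     ≡⟨ pair-of-edge e∈ ⟩
    (x , y)                      ∎
    where open ≡-Reasoning

  disjoint-relabelled : ∀ f → (∀ {x y} → f x ≡ f y → x ≡ y) → ∀ e e' →
    disjoint (relabel f e) (relabel f e') ≡ disjoint e e'
  disjoint-relabelled f f-inj (a , b) (c , d) =
    trans (disjoint-pair (f a) (f b) (f c) (f d)) (disjoint-relabel f f-inj a b c d)

  open Canonical _≟ᴱ_ using (_∈?_)

  -- the edges e ∈ allPairs whose relabelling by f lies in S; for a bijection f
  -- with inverse g this is the image of S under g, in canonical form
  preimage : (Fin n → Fin n) → List (Edge n) → List (Edge n)
  preimage f S = filter (λ e → relabel f e ∈? S) allPairs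

module Preimage {n} (f g : Fin n → Fin n) (g∘f : ∀ x → g (f x) ≡ x) (f∘g : ∀ x → f (g x) ≡ x) where
  open Canonical (_≟ᴱ_ {n}) using (_∈?_; subset-canonical; subset-unique)

  f-injective : ∀ {x y} → f x ≡ f y → x ≡ y
  f-injective {x} {y} eq = trans (sym (g∘f x)) (trans (cong g eq) (g∘f y))

  g-injective : ∀ {x y} → g x ≡ g y → x ≡ y
  g-injective {x} {y} eq = trans (sym (f∘g x)) (trans (cong f eq) (f∘g y))

  relabel-g∘f : ∀ {e} → e ∈ allPairs → relabel g (relabel f e) ≡ e
  relabel-g∘f = relabel-inverse f g g∘f

  relabel-f∘g : ∀ {e} → e ∈ allPairs → relabel f (relabel g e) ≡ e
  relabel-f∘g = relabel-inverse g f f∘g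

  ∈-preimage⁻ : ∀ {S e} → e ∈ preimage f S → e ∈ allPairs × relabel f e ∈ S
  ∈-preimage⁻ {S} = ∈-filter⁻ (λ e → relabel f e ∈? S)

  ∈-preimage⁺ : ∀ {S e} → e ∈ allPairs → relabel f e ∈ S → e ∈ preimage f S
  ∈-preimage⁺ {S} = ∈-filter⁺ (λ e → relabel f e ∈? S)

  preimage-unique : ∀ S → Unique (preimage f S)
  preimage-unique S = Unique.filter⁺ (λ e → relabel f e ∈? S) allPairs-unique

  preimage-length : ∀ {S} → S ∈ subsets allPairs → length (preimage f S) ≡ length S
  preimage-length {S} S∈ = ≤-antisym
    (length-≤-by-retraction (relabel f) (relabel g) (preimage-unique S)
      (proj₂ ∘ ∈-preimage⁻) (relabel-g∘f ∘ proj₁ ∘ ∈-preimage⁻))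
    (length-≤-by-retraction (relabel g) (relabel f) (subset-unique allPairs-unique S∈)
      (λ e∈S → ∈-preimage⁺ (relabel-∈ g g-injective (∈-subsets⇒⊆ allPairs S∈ e∈S))
                 (subst (_∈ S) (sym (relabel-f∘g (∈-subsets⇒⊆ allPairs S∈ e∈S))) e∈S))
      (relabel-f∘g ∘ ∈-subsets⇒⊆ allPairs S∈))

  preimage-matching : ∀ {S} → isMatching S ≡ true → isMatching (preimage f S) ≡ true
  preimage-matching {S} M = matching-intro (preimage-unique S) λ {e} {e'} e∈ e'∈ e≢e' →
    let (eP , fe∈S) = ∈-preimage⁻ e∈
        (e'P , fe'∈S) = ∈-preimage⁻ e'∈
        fe≢fe' = λ eq → e≢e' (trans (sym (relabel-g∘f eP))
                                (trans (cong (relabel g) eq) (relabel-g∘f e'P)))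
    in trans (sym (disjoint-relabelled f f-injective e e')) (matching-disjoint M fe∈S fe'∈S fe≢fe')

  preimage-inverse : ∀ {S} → S ∈ subsets allPairs → preimage g (preimage f S) ≡ S
  preimage-inverse {S} S∈ = sym (trans (subset-canonical allPairs-unique S∈)
    (filter-cong (_∈? S) (λ e → relabel g e ∈? preimage f S) allPairs
      (λ eP e∈S → ∈-preimage⁺ (relabel-∈ g g-injective eP) (subst (_∈ S) (sym (relabel-f∘g eP)) e∈S))
      (λ eP ge∈ → subst (_∈ S) (relabel-f∘g eP) (proj₂ (∈-preimage⁻ ge∈)))))

transpose-at-i : ∀ {n} (i j : Fin n) → transpose i j i ≡ j
transpose-at-i i j rewrite dec-true (i ≟ i) refl = refl

transpose-at-j : ∀ {n} (i j : Fin n) → transpose i j j ≡ i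
transpose-at-j i j with j ≟ i
... | yes j≡i = j≡i
... | no _ rewrite dec-true (j ≟ j) refl = refl

transpose-fixed : ∀ {n} {i j k : Fin n} → k ≢ i → k ≢ j → transpose i j k ≡ k
transpose-fixed {i = i} {j} {k} k≢i k≢j rewrite dec-false (k ≟ i) k≢i | dec-false (k ≟ j) k≢j = refl

module Compression {n} (G : Graph n) (u v : Fin n) where
  a : Fin n → Fin n → Bool
  a = adj G

  h : Fin n → Fin n → Bool
  h = compressAdj a u v

  N : Fin n → Bool
  N = inN a u v

  N-spec : ∀ {w} → N w ≡ true → w ≢ u × w ≢ v × a u w ≡ true × a v w ≡ false
  N-spec Nw =
    let (w≠u , Nw₁) = ∧-true⁻ Nw
        (w≠v , Nw₂) = ∧-true⁻ Nw₁
        (auw , ¬avw) = ∧-true⁻ Nw₂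
    in ==-false⇒≢ (not-true⁻ w≠u) , ==-false⇒≢ (not-true⁻ w≠v) , auw , not-true⁻ ¬avw

  N⇒u≢v : ∀ {w} → N w ≡ true → u ≢ v
  N⇒u≢v {w} Nw refl = let (_ , _ , auw , avw) = N-spec {w} Nw in true≢false (trans (sym auw) avw)

  N-complement : ∀ {w} → w ≢ u → w ≢ v → a u w ≡ true → N w ≡ false → a v w ≡ true
  N-complement {w} w≢u w≢v auw Nw≡false = not-false⁻ (trans (sym N-at-w) Nw≡false)
    where
    N-at-w : N w ≡ not (a v w)
    N-at-w rewrite ==-≢ w≢u | ==-≢ w≢v | auw = refl

  h-sym : ∀ p q → h p q ≡ h q p
  h-sym p q = cong₂ _∨_ (cong₂ _∧_ (Graph.sym G p q) (∧-comm (not ((p == u) ∧ N q)) (not ((q == u) ∧ N p))))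
                        (∨-comm ((p == v) ∧ N q) ((q == v) ∧ N p))

  data HEdge (p q : Fin n) : Set where
    kept   : a p q ≡ true → (p ≡ u → N q ≡ false) → (q ≡ u → N p ≡ false) → HEdge p q
    new-pq : p ≡ v → N q ≡ true → HEdge p q
    new-qp : q ≡ v → N p ≡ true → HEdge p q

  h-view : ∀ {p q} → h p q ≡ true → HEdge p q
  h-view {p} {q} hpq with ∨-true⁻ hpq
  ... | inj₁ old = let (apq , ¬uq , ¬up) = ∧-true⁻′ old in kept apq (excluded ¬uq) (excluded ¬up)
    where
    ∧-true⁻′ : ∀ {x y z} → x ∧ y ∧ z ≡ true → x ≡ true × y ≡ true × z ≡ true
    ∧-true⁻′ eq = let (x , yz) = ∧-true⁻ eq in x , ∧-true⁻ yz
    excluded : ∀ {x y : Fin n} {b} → not ((x == y) ∧ b) ≡ true → x ≡ y → b ≡ false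
    excluded {x} nb refl rewrite ==-refl x = not-true⁻ nb
  ... | inj₂ new with ∨-true⁻ new
  ...   | inj₁ pq = let (p==v , Nq) = ∧-true⁻ pq in new-pq (==-sound p==v) Nq
  ...   | inj₂ qp = let (q==v , Np) = ∧-true⁻ qp in new-qp (==-sound q==v) Np

  h-new : ∀ {p q} → h p q ≡ true → a p q ≡ false → (p ≡ v × N q ≡ true) ⊎ (q ≡ v × N p ≡ true)
  h-new hpq ¬apq with h-view hpq
  ... | kept apq _ _     = contradiction (trans (sym apq) ¬apq) true≢false
  ... | new-pq p≡v Nq   = inj₁ (p≡v , Nq)
  ... | new-qp q≡v Np   = inj₂ (q≡v , Np)

  h-removed : ∀ {w} → N w ≡ true → h u w ≢ true
  h-removed {w} Nw huw with h-view huw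
  ... | kept _ Nw≡false _ = contradiction (trans (sym Nw) (Nw≡false refl)) true≢false
  ... | new-pq u≡v _      = N⇒u≢v {w} Nw u≡v
  ... | new-qp w≡v _      = proj₁ (proj₂ (N-spec {w} Nw)) w≡v

  h-at-u : ∀ {z} → u ≢ v → z ≢ v → h u z ≡ true → a v z ≡ true
  h-at-u {z} u≢v z≢v huz with h-view huz
  ... | kept auz Nz≡false _ = N-complement z≢u z≢v auz (Nz≡false refl)
    where
    z≢u : z ≢ u
    z≢u refl = true≢false (trans (sym auz) (Graph.irrefl G u))
  ... | new-pq u≡v _ = contradiction u≡v u≢v
  ... | new-qp z≡v _ = contradiction z≡v z≢v

  τ τ' : Fin n → Fin n
  τ  = transpose u v
  τ' = transpose v u

  open Preimage τ τ' (λ _ → transpose-inverse v u) (λ _ → transpose-inverse u v)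
  open Canonical (_≟ᴱ_ {n}) using (_∈?_)

  NewEdgeAt : Fin n → List (Edge n) → Set
  NewEdgeAt x S = ∃ λ w → N w ≡ true × pair x w ∈ S

  newEdgeAt? : ∀ x S → Dec (NewEdgeAt x S)
  newEdgeAt? x S = any? (λ w → (N w ≟ᴮ true) ×-dec (pair x w ∈? S))

  -- A matching of H that uses a new edge v–w is moved to G by swapping u and
  -- v; any other matching of H already lies in G.  The inverse recognises the
  -- swapped matchings by their edge u–w, which no edge set of H contains.
  transfer : List (Edge n) → List (Edge n)
  transfer S with newEdgeAt? v S
  ... | yes _ = preimage τ S
  ... | no _  = S

  recover : List (Edge n) → List (Edge n)
  recover T with newEdgeAt? u T
  ... | yes _ = preimage τ' T
  ... | no _  = T

  h-edge : ∀ {S} → InGraph h S → ∀ {x y} → pair x y ∈ S → h x y ≡ true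
  h-edge inH {x} {y} xy∈ = trans (sym (joins-pair h h-sym x y)) (inH xy∈)

  stays-in-G : ∀ {S} → S ∈ subsets allPairs → InGraph h S → ¬ NewEdgeAt v S → InGraph a S
  stays-in-G {S} S∈ inH ¬new {p , q} e∈ with a p q in apq | ∈-subsets⇒⊆ allPairs S∈ e∈
  ... | true  | _   = refl
  ... | false | e∈P with h-new (inH e∈) apq
  ...   | inj₁ (refl , Nq) = ⊥-elim (¬new (q , Nq , subst (_∈ S) (sym (pair-of-edge e∈P)) e∈))
  ...   | inj₂ (refl , Np) =
    ⊥-elim (¬new (p , Np , subst (_∈ S) (sym (trans (pair-comm (allPairs-irrefl e∈P ∘ sym)) (pair-of-edge e∈P))) e∈))

  no-new-edge-at-u : ∀ {S} → InGraph h S → ¬ NewEdgeAt u S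
  no-new-edge-at-u inH (w , Nw , uw∈) = h-removed {w} Nw (h-edge inH uw∈)

  -- A matching S of H with a new edge v–w.  Then τ' maps every edge of S to an
  -- edge of G: v–w goes to u–w, the edges u–y to v–y, the others stay.
  module Swapped {S} (MS : MatchingOf h S) {w} (Nw : N w ≡ true) (vw∈ : pair v w ∈ S) where
    open MatchingOf MS

    w≢u : w ≢ u
    w≢u = proj₁ (N-spec {w} Nw)

    w≢v : w ≢ v
    w≢v = proj₁ (proj₂ (N-spec {w} Nw))

    u≢v : u ≢ v
    u≢v = N⇒u≢v {w} Nw

    τ'-fixed : ∀ {x} → x ≢ u → x ≢ v → τ' x ≡ x
    τ'-fixed x≢u x≢v = transpose-fixed x≢v x≢u

    at-v : ∀ {y} → pair v y ∈ S → a (τ' v) (τ' y) ≡ true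
    at-v vy∈ with matching-partner-unique matching vy∈ vw∈
    ... | refl rewrite transpose-at-i v u | τ'-fixed w≢u w≢v = proj₁ (proj₂ (proj₂ (N-spec {w} Nw)))

    -- an edge u–y of S has y ≠ v (v is matched to w), and τ' sends it to v–y
    at-u : ∀ {y} → pair u y ∈ S → a (τ' u) (τ' y) ≡ true
    at-u {y} uy∈ = subst₂ (λ s t → a s t ≡ true) (sym (transpose-at-j v u)) (sym (τ'-fixed y≢u y≢v))
                          (h-at-u u≢v y≢v (h-edge in-graph uy∈))
      where
      y≢u : y ≢ u
      y≢u = pair-proper (∈-subsets⇒⊆ allPairs subset uy∈) ∘ sym
      y≢v : y ≢ v
      y≢v refl = w≢u (sym (matching-partner-unique matching (subst (_∈ S) (pair-comm u≢v) uy∈) vw∈))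

    away : ∀ {x y} → x ≢ u → x ≢ v → y ≢ u → y ≢ v → pair x y ∈ S → a (τ' x) (τ' y) ≡ true
    away {x} {y} x≢u x≢v y≢u y≢v xy∈ rewrite τ'-fixed x≢u x≢v | τ'-fixed y≢u y≢v with a x y in axy
    ... | true = refl
    ... | false with h-new (h-edge in-graph xy∈) axy
    ...   | inj₁ (x≡v , _) = contradiction x≡v x≢v
    ...   | inj₂ (y≡v , _) = contradiction y≡v y≢v

    by-position : ∀ {x y} → Dec (x ≡ u) → Dec (x ≡ v) → Dec (y ≡ u) → Dec (y ≡ v) →
                  pair x y ∈ S → a (τ' x) (τ' y) ≡ true
    by-position (yes refl) _ _ _ = at-u
    by-position (no _) (yes refl) _ _ = at-v
    by-position (no x≢u) (no _) (yes refl) _ xy∈ =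
      trans (Graph.sym G _ _) (at-u (subst (_∈ S) (pair-comm x≢u) xy∈))
    by-position (no _) (no x≢v) (no _) (yes refl) xy∈ =
      trans (Graph.sym G _ _) (at-v (subst (_∈ S) (pair-comm x≢v) xy∈))
    by-position (no x≢u) (no x≢v) (no y≢u) (no y≢v) = away x≢u x≢v y≢u y≢v

    swapped-edge : ∀ {x y} → pair x y ∈ S → a (τ' x) (τ' y) ≡ true
    swapped-edge {x} {y} = by-position (x ≟ u) (x ≟ v) (y ≟ u) (y ≟ v)

    -- hence the swapped set lies in G: e is in it when τ e ∈ S, and τ' undoes τ
    swapped-in-G : InGraph a (preimage τ S)
    swapped-in-G {p , q} e∈ = subst₂ (λ s t → a s t ≡ true) (transpose-inverse v u) (transpose-inverse v u)
                                     (swapped-edge (proj₂ (∈-preimage⁻ e∈)))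

    swapped-new-edge : NewEdgeAt u (preimage τ S)
    swapped-new-edge = w , Nw , ∈-preimage⁺ (pair∈allPairs (w≢u ∘ sym)) (subst (_∈ S) (sym τuw) vw∈)
      where
      τuw : relabel τ (pair u w) ≡ pair v w
      τuw = trans (relabel-pair τ {u} {w} (w≢u ∘ sym ∘ f-injective))
                  (cong₂ pair (transpose-at-i u v) (transpose-fixed w≢u w≢v))

  transfer-matching : ∀ {S} → MatchingOf h S → MatchingOf a (transfer S)
  transfer-matching {S} MS with newEdgeAt? v S
  ... | yes (w , Nw , vw∈) = record
    { subset   = filter∈subsets (λ e → relabel τ e ∈? S) allPairs
    ; in-graph = Swapped.swapped-in-G MS Nw vw∈
    ; matching = preimage-matching (MatchingOf.matching MS)
    }
  ... | no ¬new = record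
    { subset   = MatchingOf.subset MS
    ; in-graph = stays-in-G (MatchingOf.subset MS) (MatchingOf.in-graph MS) ¬new
    ; matching = MatchingOf.matching MS
    }

  transfer-length : ∀ {S} → S ∈ subsets allPairs → length (transfer S) ≡ length S
  transfer-length {S} S∈ with newEdgeAt? v S
  ... | yes _ = preimage-length S∈
  ... | no _  = refl

  recover-transfer : ∀ {S} → MatchingOf h S → recover (transfer S) ≡ S
  recover-transfer {S} MS with newEdgeAt? v S
  ... | yes (w , Nw , vw∈) with newEdgeAt? u (preimage τ S)
  ...   | yes _   = preimage-inverse (MatchingOf.subset MS)
  ...   | no ¬new = contradiction (Swapped.swapped-new-edge MS Nw vw∈) ¬new
  recover-transfer {S} MS | no _ with newEdgeAt? u S
  ...   | yes new = contradiction new (no-new-edge-at-u (MatchingOf.in-graph MS))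
  ...   | no _    = refl

module _ {n : ℕ} where
  Matchings : (Fin n → Fin n → Bool) → ℕ → List (List (Edge n))
  Matchings b k = filterᵇ (λ M → ⌊ length M Nat.≟ k ⌋ ∧ isMatching M) (subsets (edges b))

  subsets-edges : ∀ b → subsets (edges b) ≡ filterᵇ (allB (joins b)) (subsets (allPairs {n}))
  subsets-edges b = trans (cong subsets (edges-filter b)) (subsets-filter (joins b) allPairs)

  ∈-Matchings⁻ : ∀ {b k M} → M ∈ Matchings b k → MatchingOf b M × length M ≡ k
  ∈-Matchings⁻ {b} {k} {M} M∈ =
    let (M∈subsets , size-and-matching) = ∈-filter⁻ (λ M → T? (⌊ length M Nat.≟ k ⌋ ∧ isMatching M)) M∈
        (size , matching) = Equivalence.to T-∧ size-and-matching
        (M∈all , in-graph) = ∈-filter⁻ (T? ∘ allB (joins b)) (subst (M ∈_) (subsets-edges b) M∈subsets)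
    in record { subset   = M∈all
              ; in-graph = allB⁻ (joins b) (Equivalence.to T-≡ in-graph)
              ; matching = Equivalence.to T-≡ matching }
       , toWitness size

  ∈-Matchings⁺ : ∀ {b k M} → MatchingOf b M → length M ≡ k → M ∈ Matchings b k
  ∈-Matchings⁺ {b} {k} {M} MO size = ∈-filter⁺ (λ M → T? (⌊ length M Nat.≟ k ⌋ ∧ isMatching M))
    (subst (M ∈_) (sym (subsets-edges b))
      (∈-filter⁺ (T? ∘ allB (joins b)) subset (Equivalence.from T-≡ (allB⁺ (joins b) M in-graph))))
    (Equivalence.from T-∧ (fromWitness size , Equivalence.from T-≡ matching))
    where open MatchingOf MO

  Matchings-unique : ∀ b k → Unique (Matchings b k)
  Matchings-unique b k = Unique.filter⁺ _ (subsets-unique edges-unique)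
    where
    edges-unique : Unique (edges b)
    edges-unique = subst Unique (sym (edges-filter b)) (Unique.filter⁺ _ allPairs-unique)

lemma3p2 : ∀ {n} (G : Graph n) (side : Fin n → Bool) → IsBipartition G side →
    (u v : Fin n) → side u ≡ true → side v ≡ true →
    (k : ℕ) → mk (compressAdj (adj G) u v) k ≤ mk (adj G) k
lemma3p2 G _ _ u v _ _ k =
  length-≤-by-retraction transfer recover (Matchings-unique h k) transfer-into (recover-transfer ∘ proj₁ ∘ ∈-Matchings⁻)
  where
  open Compression G u v
  transfer-into : ∀ {S} → S ∈ Matchings h k → transfer S ∈ Matchings a k
  transfer-into S∈ = let (MS , size) = ∈-Matchings⁻ S∈
                     in ∈-Matchings⁺ (transfer-matching MS) (trans (transfer-length (MatchingOf.subset MS)) size)
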